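{- Let $a^2,b^2,c^2,d^2,e^2,f^2,g^2,h^2,i^2$ be a primitive magic square of squares (arranged with $a^2,b^2,c^2$ in the top row, $d^2,e^2,f^2$ in the middle row, $g^2,h^2,i^2$ in the bottom row). If a prime $p\equiv 5 \pmod 8$ divides the central entry $e^2$, then none of the mid-edge entries $b^2,d^2,f^2,h^2$ (the other entries of the middle row and middle column) is divisible by $p$.
   Context: A magic square of squares is a $3\times 3$ grid of $9$ distinct integer squares such that the entries of each row, each column and both main diagonals sum to the same total $T$ (necessarily $T=3e^2$). It is primitive if the greatest common divisor of all its entries is $1$. -}

module Defs where

open import Data.Nat using (ℕ; _+_; _*_)
open import Data.Nat.GCD using (gcd)
open import Data.Product using (_×_)
open import Relation.Binary.PropositionalEquality using (_≡_; _≢_)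

sq : ℕ → ℕ
sq x = x * x

AllDistinct : (A B C D E F G H I : ℕ) → Set
AllDistinct A B C D E F G H I =
  A ≢ B × A ≢ C × A ≢ D × A ≢ E × A ≢ F × A ≢ G × A ≢ H × A ≢ I ×
  B ≢ C × B ≢ D × B ≢ E × B ≢ F × B ≢ G × B ≢ H × B ≢ I ×
  C ≢ D × C ≢ E × C ≢ F × C ≢ G × C ≢ H × C ≢ I ×
  D ≢ E × D ≢ F × D ≢ G × D ≢ H × D ≢ I ×
  E ≢ F × E ≢ G × E ≢ H × E ≢ I ×
  F ≢ G × F ≢ H × F ≢ I ×
  G ≢ H × G ≢ I ×
  H ≢ I

IsMagic : (A B C D E F G H I : ℕ) → Set
IsMagic A B C D E F G H I =
  AllDistinct A B C D E F G H I ×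
  (A + B + C ≡ D + E + F) × (A + B + C ≡ G + H + I) ×
  (A + B + C ≡ A + D + G) × (A + B + C ≡ B + E + H) × (A + B + C ≡ C + F + I) ×
  (A + B + C ≡ A + E + I) × (A + B + C ≡ C + E + G)

Primitive9 : (A B C D E F G H I : ℕ) → Set
Primitive9 A B C D E F G H I =
  gcd A (gcd B (gcd C (gcd D (gcd E (gcd F (gcd G (gcd H I))))))) ≡ 1

IsPrimitiveMagicSquareOfSquares : (a b c d e f g h i : ℕ) → Set
IsPrimitiveMagicSquareOfSquares a b c d e f g h i =
  IsMagic (sq a) (sq b) (sq c) (sq d) (sq e) (sq f) (sq g) (sq h) (sq i) ×
  Primitive9 (sq a) (sq b) (sq c) (sq d) (sq e) (sq f) (sq g) (sq h) (sq i)

{-# OPTIONS --safe #-}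
-- If p ≡ 5 (mod 8) then −2 is not a square mod p, so p ∣ x² + 2y² forces p ∣ y: otherwise
-- Thue's lemma gives 0 < u² + 2v² < 3p with p ∣ y²(u² + 2v²), while neither p nor 2p has the
-- form u² + 2v² (look mod 8 and mod 16). In a magic square with centre E one has
-- B + D + 2A = 4E and X + Y = 2E for opposite entries X, Y. So if p divides E and the edge b²
-- (or d²), it divides d² + 2a² (resp. b² + 2a²), hence a, hence A, B and D, and then every
-- entry, contradicting primitivity.
module Submission where

open import Defs
open import Data.Fin using (Fin; toℕ; fromℕ<; remQuot; combine)
import Data.Fin.Properties as Fin
open import Data.Product using (_×_; _,_; ∃; ∃₂; proj₁; proj₂; uncurry)
open import Function using (_∘_)
open import Relation.Binary.PropositionalEquality
open import Relation.Nullary using (¬_; yes; no)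

module Thue where

  open import Data.Integer
  open import Data.Integer.DivMod using (_%ℕ_; _/ℕ_; a≡a%ℕn+[a/ℕn]*n; n%ℕd<d)
  open import Data.Integer.Properties
    using (m-n≡m⊖n; ∣m⊝n∣≤m⊔n; i-j≡0⇒i≡j; +-injective; +◃n≡+n; pos-+; pos-*; ∣i∣≡0⇒i≡0)
  open import Data.Integer.Divisibility.Signed
    using (_∣_; divides; ∣ᵤ⇒∣; ∣⇒∣ᵤ; ∣m∣n⇒∣m+n; ∣m⇒∣m*n; ∣n⇒∣m*n)
  open import Data.Integer.Tactic.RingSolver using (solve-∀)
  import Data.Nat as ℕ
  import Data.Nat.Properties as ℕ
  import Data.Nat.Divisibility as ℕ

  %ℕ-≡⇒∣- : ∀ {i j} d .{{_ : ℕ.NonZero d}} → i %ℕ d ≡ j %ℕ d → + d ∣ i - j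
  %ℕ-≡⇒∣- {i} {j} d eq = divides (i /ℕ d - j /ℕ d) (begin
    i - j
      ≡⟨ cong₂ _-_ (a≡a%ℕn+[a/ℕn]*n i d) (a≡a%ℕn+[a/ℕn]*n j d) ⟩
    (+ (i %ℕ d) + i /ℕ d * + d) - (+ (j %ℕ d) + j /ℕ d * + d)
      ≡⟨ cong (λ r → (+ (i %ℕ d) + i /ℕ d * + d) - (+ r + j /ℕ d * + d)) eq ⟨
    (+ (i %ℕ d) + i /ℕ d * + d) - (+ (i %ℕ d) + j /ℕ d * + d)
      ≡⟨ cancel (+ (i %ℕ d)) (i /ℕ d) (j /ℕ d) (+ d) ⟩
    (i /ℕ d - j /ℕ d) * + d
      ∎)
    where
    open ≡-Reasoning
    cancel : ∀ r a b q → (r + a * q) - (r + b * q) ≡ (a - b) * q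
    cancel = solve-∀

  pigeonhole-× : ∀ {m n k} → m ℕ.< n ℕ.* k → (f : Fin n × Fin k → Fin m) →
                 ∃₂ λ a b → a ≢ b × f a ≡ f b
  pigeonhole-× {n = n} {k = k} m<nk f with i , j , i<j , fi≡fj ← Fin.pigeonhole m<nk (f ∘ remQuot k) =
    remQuot k i , remQuot k j , (λ eq → Fin.<-irrefl (remQuot-injective eq) i<j) , fi≡fj
    where
    remQuot-injective : remQuot k i ≡ remQuot k j → i ≡ j
    remQuot-injective eq = begin
      i                                  ≡⟨ Fin.combine-remQuot {n} k i ⟨
      uncurry combine (remQuot {n} k i)  ≡⟨ cong (uncurry combine) eq ⟩
      uncurry combine (remQuot {n} k j)  ≡⟨ Fin.combine-remQuot {n} k j ⟩
      j                                  ∎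
      where open ≡-Reasoning

  ∣toℕ-toℕ∣≤ : ∀ {m} (i j : Fin (ℕ.suc m)) → ∣ + toℕ i - + toℕ j ∣ ℕ.≤ m
  ∣toℕ-toℕ∣≤ i j = ℕ.≤-trans (ℕ.≤-reflexive (cong ∣_∣ (m-n≡m⊖n (toℕ i) (toℕ j))))
    (ℕ.≤-trans (∣m⊝n∣≤m⊔n (toℕ i) (toℕ j)) (ℕ.⊔-lub (Fin.toℕ≤pred[n] i) (Fin.toℕ≤pred[n] j)))

  toℕ-toℕ≡0⇒≡ : ∀ {n} (i j : Fin n) → + toℕ i - + toℕ j ≡ 0ℤ → i ≡ j
  toℕ-toℕ≡0⇒≡ i j eq = Fin.toℕ-injective (+-injective (i-j≡0⇒i≡j _ _ eq))

  residueOf : ∀ p .{{_ : ℕ.NonZero p}} → ℤ → Fin p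
  residueOf p i = fromℕ< (n%ℕd<d i p)

  residueOf-≡⇒∣- : ∀ p .{{_ : ℕ.NonZero p}} {i j} → residueOf p i ≡ residueOf p j → + p ∣ i - j
  residueOf-≡⇒∣- p {i} {j} eq =
    %ℕ-≡⇒∣- {i} {j} p (trans (sym (Fin.toℕ-fromℕ< _)) (trans (cong toℕ eq) (Fin.toℕ-fromℕ< _)))

  combination : ∀ {m} → ℤ → ℤ → Fin m × Fin m → ℤ
  combination x y (i , j) = + toℕ i * x + + toℕ j * y

  thue : ∀ p m x y .{{_ : ℕ.NonZero p}} → p ℕ.< sq (ℕ.suc m) →
         ∃₂ λ u v → ∣ u ∣ ℕ.≤ m × ∣ v ∣ ℕ.≤ m × (u , v) ≢ (0ℤ , 0ℤ) × + p ∣ u * x + v * y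
  thue p m x y p<[1+m]²
    with (i₁ , j₁) , (i₂ , j₂) , ij₁≢ij₂ , same-residue
           ← pigeonhole-× p<[1+m]² (residueOf p ∘ combination x y) =
    + toℕ i₁ - + toℕ i₂ , + toℕ j₁ - + toℕ j₂ , ∣toℕ-toℕ∣≤ i₁ i₂ , ∣toℕ-toℕ∣≤ j₁ j₂ ,
    (λ eq → ij₁≢ij₂ (cong₂ _,_ (toℕ-toℕ≡0⇒≡ i₁ i₂ (cong proj₁ eq)) (toℕ-toℕ≡0⇒≡ j₁ j₂ (cong proj₂ eq)))) ,
    subst (+ p ∣_) (regroup (+ toℕ i₁) (+ toℕ j₁) (+ toℕ i₂) (+ toℕ j₂) x y)
      (residueOf-≡⇒∣- p {combination x y (i₁ , j₁)} {combination x y (i₂ , j₂)} same-residue)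
    where
    regroup : ∀ a b c d x y → (a * x + b * y) - (c * x + d * y) ≡ (a - c) * x + (b - d) * y
    regroup = solve-∀

  sq-∣∣ : ∀ i → i * i ≡ + (sq ∣ i ∣)
  sq-∣∣ (+ n)    = +◃n≡+n (n ℕ.* n)
  sq-∣∣ -[1+ n ] = +◃n≡+n (ℕ.suc n ℕ.* ℕ.suc n)

  sq+2sq-∣∣ : ∀ u v → u * u + + 2 * (v * v) ≡ + (sq ∣ u ∣ ℕ.+ 2 ℕ.* sq ∣ v ∣)
  sq+2sq-∣∣ u v = begin
    u * u + + 2 * (v * v)              ≡⟨ cong₂ (λ a b → a + + 2 * b) (sq-∣∣ u) (sq-∣∣ v) ⟩
    + (sq ∣ u ∣) + + 2 * + (sq ∣ v ∣)  ≡⟨ cong (_+_ (+ (sq ∣ u ∣))) (pos-* 2 (sq ∣ v ∣)) ⟨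
    + (sq ∣ u ∣) + + (2 ℕ.* sq ∣ v ∣)  ≡⟨ pos-+ (sq ∣ u ∣) (2 ℕ.* sq ∣ v ∣) ⟨
    + (sq ∣ u ∣ ℕ.+ 2 ℕ.* sq ∣ v ∣)    ∎
    where open ≡-Reasoning

  factorise : ∀ u v x y → y * y * (u * u + + 2 * (v * v))
                         ≡ (u * y + v * x) * (u * y - v * x) + v * v * (x * x + + 2 * (y * y))
  factorise = solve-∀

  ∣y²[u²+2v²] : ∀ {p} x y u v → + p ∣ u * + y + v * + x → p ℕ.∣ sq x ℕ.+ 2 ℕ.* sq y →
                p ℕ.∣ sq y ℕ.* (sq ∣ u ∣ ℕ.+ 2 ℕ.* sq ∣ v ∣)
  ∣y²[u²+2v²] {p} x y u v p∣uy+vx p∣x²+2y² =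
    ∣⇒∣ᵤ {i = + (sq y ℕ.* (sq ∣ u ∣ ℕ.+ 2 ℕ.* sq ∣ v ∣))} (subst (+ p ∣_) y²[u²+2v²]≡ p∣Y²[u²+2v²])
    where
    p∣x²+2y²ℤ : + p ∣ + x * + x + + 2 * (+ y * + y)
    p∣x²+2y²ℤ = subst (+ p ∣_) (sym (sq+2sq-∣∣ (+ x) (+ y))) (∣ᵤ⇒∣ {i = + (sq x ℕ.+ 2 ℕ.* sq y)} p∣x²+2y²)
    p∣Y²[u²+2v²] : + p ∣ + y * + y * (u * u + + 2 * (v * v))
    p∣Y²[u²+2v²] = subst (+ p ∣_) (sym (factorise u v (+ x) (+ y)))
      (∣m∣n⇒∣m+n (∣m⇒∣m*n (u * + y - v * + x) p∣uy+vx) (∣n⇒∣m*n (v * v) p∣x²+2y²ℤ))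
    y²[u²+2v²]≡ : + y * + y * (u * u + + 2 * (v * v)) ≡ + (sq y ℕ.* (sq ∣ u ∣ ℕ.+ 2 ℕ.* sq ∣ v ∣))
    y²[u²+2v²]≡ = trans (cong₂ _*_ (sq-∣∣ (+ y)) (sq+2sq-∣∣ u v)) (sym (pos-* (sq y) _))

  abs-pair≢0 : ∀ {u v} → (u , v) ≢ (0ℤ , 0ℤ) → (∣ u ∣ , ∣ v ∣) ≢ (0 , 0)
  abs-pair≢0 uv≢0 eq = uv≢0 (cong₂ _,_ (∣i∣≡0⇒i≡0 (cong proj₁ eq)) (∣i∣≡0⇒i≡0 (cong proj₂ eq)))

  thue-sq+2sq : ∀ p m x y .{{_ : ℕ.NonZero p}} → p ℕ.< sq (ℕ.suc m) →
                p ℕ.∣ sq x ℕ.+ 2 ℕ.* sq y →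
                ∃₂ λ U V → U ℕ.≤ m × V ℕ.≤ m × (U , V) ≢ (0 , 0) ×
                           p ℕ.∣ sq y ℕ.* (sq U ℕ.+ 2 ℕ.* sq V)
  thue-sq+2sq p m x y p<[1+m]² p∣x²+2y² =
    let u , v , ∣u∣≤m , ∣v∣≤m , uv≢0 , p∣uy+vx = thue p m (+ y) (+ x) p<[1+m]²
    in ∣ u ∣ , ∣ v ∣ , ∣u∣≤m , ∣v∣≤m , abs-pair≢0 uv≢0 , ∣y²[u²+2v²] x y u v p∣uy+vx p∣x²+2y²

open Thue using (thue-sq+2sq)

open import Data.Nat
open import Data.Nat.Properties
open import Data.Nat.DivMod
open import Data.Nat.Divisibility
  using (_∣_; divides; _∣?_; ∣1⇒≡1; ∣m∣n⇒∣m+n; ∣m+n∣m⇒∣n; ∣m⇒∣m*n; ∣n⇒∣m*n)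
open import Data.Nat.GCD using (gcd-greatest)
open import Data.Nat.Primality using (Prime; ¬prime[1]; prime⇒nonZero; euclidsLemma)
open import Data.Nat.Tactic.RingSolver using (solve)
open import Data.List using ([]; _∷_)
open import Data.Sum using (inj₁; inj₂)
open import Data.Empty using (⊥-elim)
open import Relation.Nullary.Decidable using (toWitness; ¬?; decidable-stable)

module _ {n} .{{_ : NonZero n}} where

  %-cong-+ : ∀ {a a′ b b′} → a % n ≡ a′ % n → b % n ≡ b′ % n → (a + b) % n ≡ (a′ + b′) % n
  %-cong-+ {a} {a′} {b} {b′} a≡ b≡ = begin
    (a + b) % n             ≡⟨ %-distribˡ-+ a b n ⟩
    (a % n + b % n) % n     ≡⟨ cong₂ (λ r s → (r + s) % n) a≡ b≡ ⟩
    (a′ % n + b′ % n) % n   ≡⟨ %-distribˡ-+ a′ b′ n ⟨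
    (a′ + b′) % n           ∎
    where open ≡-Reasoning

  %-cong-* : ∀ {a a′ b b′} → a % n ≡ a′ % n → b % n ≡ b′ % n → (a * b) % n ≡ (a′ * b′) % n
  %-cong-* {a} {a′} {b} {b′} a≡ b≡ = begin
    (a * b) % n              ≡⟨ %-distribˡ-* a b n ⟩
    (a % n * (b % n)) % n    ≡⟨ cong₂ (λ r s → (r * s) % n) a≡ b≡ ⟩
    (a′ % n * (b′ % n)) % n  ≡⟨ %-distribˡ-* a′ b′ n ⟨
    (a′ * b′) % n            ∎
    where open ≡-Reasoning

  sq+2sq-%-reduce : ∀ x y → (sq x + 2 * sq y) % n ≡ (sq (x % n) + 2 * sq (y % n)) % n
  sq+2sq-%-reduce x y = %-cong-+ (%-cong-* x≡ x≡) (%-cong-* {2} refl (%-cong-* y≡ y≡))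
    where
    x≡ : x % n ≡ x % n % n
    x≡ = sym (m%n%n≡m%n x n)
    y≡ : y % n ≡ y % n % n
    y≡ = sym (m%n%n≡m%n y n)

  sq+2sq-avoids-residue : ∀ {t} → (∀ (r s : Fin n) → (sq (toℕ r) + 2 * sq (toℕ s)) % n ≢ t) →
                          ∀ x y → (sq x + 2 * sq y) % n ≢ t
  sq+2sq-avoids-residue {t} residues x y eq =
    residues r s (begin
      (sq (toℕ r) + 2 * sq (toℕ s)) % n
        ≡⟨ cong₂ (λ r s → (sq r + 2 * sq s) % n) (Fin.toℕ-fromℕ< (m%n<n x n)) (Fin.toℕ-fromℕ< (m%n<n y n)) ⟩
      (sq (x % n) + 2 * sq (y % n)) % n   ≡⟨ sq+2sq-%-reduce x y ⟨
      (sq x + 2 * sq y) % n               ≡⟨ eq ⟩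
      t                                   ∎)
    where
    open ≡-Reasoning
    r s : Fin n
    r = fromℕ< (m%n<n x n)
    s = fromℕ< (m%n<n y n)

sq+2sq%8≢5 : ∀ x y → (sq x + 2 * sq y) % 8 ≢ 5
sq+2sq%8≢5 = sq+2sq-avoids-residue (toWitness {a? = Fin.all? λ r → Fin.all? λ s → ¬? (_ ≟ 5)} _)

sq+2sq%16≢10 : ∀ x y → (sq x + 2 * sq y) % 16 ≢ 10
sq+2sq%16≢10 = sq+2sq-avoids-residue (toWitness {a? = Fin.all? λ r → Fin.all? λ s → ¬? (_ ≟ 10)} _)

p∣sq+2sq<3p⇒≡0 : ∀ {p} x y → p % 8 ≡ 5 → p ∣ sq x + 2 * sq y → sq x + 2 * sq y < 3 * p →
                  sq x + 2 * sq y ≡ 0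
p∣sq+2sq<3p⇒≡0 x y p%8≡5 (divides 0 eq) _ = eq
p∣sq+2sq<3p⇒≡0 {p} x y p%8≡5 (divides 1 eq) _ =
  ⊥-elim (sq+2sq%8≢5 x y (trans (cong (_% 8) (trans eq (*-identityˡ p))) p%8≡5))
p∣sq+2sq<3p⇒≡0 {p} x y p%8≡5 (divides 2 eq) _ =
  ⊥-elim (sq+2sq%16≢10 x y (begin
    (sq x + 2 * sq y) % 16   ≡⟨ cong (_% 16) (trans eq (*-comm 2 p)) ⟩
    p * 2 % 16               ≡⟨ m%n*o≡m*o%[n*o] p 8 2 ⟨
    p % 8 * 2                ≡⟨ cong (_* 2) p%8≡5 ⟩
    10                       ∎))
  where open ≡-Reasoning
p∣sq+2sq<3p⇒≡0 {p} x y p%8≡5 (divides (suc (suc (suc q))) eq) N<3p =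
  ⊥-elim (<⇒≱ N<3p (subst (3 * p ≤_) (sym eq) (*-monoˡ-≤ p {3} {3 + q} (s≤s (s≤s (s≤s z≤n))))))

integerSqrt : ∀ n → ∃ λ m → sq m ≤ n × n < sq (suc m)
integerSqrt zero = 0 , z≤n , s≤s z≤n
integerSqrt (suc n) with m , m²≤n , n<[1+m]² ← integerSqrt n with suc n <? sq (suc m)
... | yes 1+n<[1+m]² = m , m≤n⇒m≤1+n m²≤n , 1+n<[1+m]²
... | no  1+n≮[1+m]² = suc m , ≤-reflexive [1+m]²≡1+n ,
        subst (_< sq (suc (suc m))) [1+m]²≡1+n (*-mono-< (n<1+n (suc m)) (n<1+n (suc m)))
  where
  [1+m]²≡1+n : sq (suc m) ≡ suc n
  [1+m]²≡1+n = ≤-antisym (≮⇒≥ 1+n≮[1+m]²) n<[1+m]²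

sq≢p : ∀ {p} m → p % 8 ≡ 5 → sq m ≢ p
sq≢p m p%8≡5 m²≡p = sq+2sq%8≢5 m 0 (trans (cong (_% 8) (trans (+-identityʳ (sq m)) m²≡p)) p%8≡5)

sq+2sq<3*p : ∀ {p m U V} → sq m < p → U ≤ m → V ≤ m → sq U + 2 * sq V < 3 * p
sq+2sq<3*p {p} {m} {U} {V} m²<p U≤m V≤m = begin-strict
  sq U + 2 * sq V   ≤⟨ +-mono-≤ (*-mono-≤ U≤m U≤m) (*-monoʳ-≤ 2 (*-mono-≤ V≤m V≤m)) ⟩
  sq m + 2 * sq m   <⟨ +-mono-<-≤ m²<p (*-monoʳ-≤ 2 (<⇒≤ m²<p)) ⟩
  p + 2 * p         ≡⟨ solve (p ∷ []) ⟩
  3 * p             ∎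
  where open ≤-Reasoning

sq+2sq≡0⇒≡0 : ∀ U V → sq U + 2 * sq V ≡ 0 → (U , V) ≡ (0 , 0)
sq+2sq≡0⇒≡0 zero zero _ = refl

prime∣sq*⇒∣ : ∀ {p y n} → Prime p → ¬ p ∣ y → p ∣ sq y * n → p ∣ n
prime∣sq*⇒∣ {y = y} {n} p-prime p∤y p∣y²n with euclidsLemma (sq y) n p-prime p∣y²n
... | inj₂ p∣n  = p∣n
... | inj₁ p∣y² with euclidsLemma y y p-prime p∣y²
...   | inj₁ p∣y = ⊥-elim (p∤y p∣y)
...   | inj₂ p∣y = ⊥-elim (p∤y p∣y)

p∣sq+2sq⇒p∣y : ∀ {p} x y → Prime p → p % 8 ≡ 5 → p ∣ sq x + 2 * sq y → p ∣ y
p∣sq+2sq⇒p∣y {p} x y p-prime p%8≡5 p∣x²+2y² = decidable-stable (p ∣? y) ¬p∤y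
  where
  instance
    p≢0 : NonZero p
    p≢0 = prime⇒nonZero p-prime
  ¬p∤y : ¬ ¬ p ∣ y
  ¬p∤y p∤y =
    let m , m²≤p , p<[1+m]² = integerSqrt p
        U , V , U≤m , V≤m , UV≢0 , p∣y²[U²+2V²] = thue-sq+2sq p m x y p<[1+m]² p∣x²+2y²
    in UV≢0 (sq+2sq≡0⇒≡0 U V (p∣sq+2sq<3p⇒≡0 U V p%8≡5 (prime∣sq*⇒∣ p-prime p∤y p∣y²[U²+2V²])
         (sq+2sq<3*p (≤∧≢⇒< m²≤p (sq≢p m p%8≡5)) U≤m V≤m)))

p∣sq+2sq⇒p∣sq-both : ∀ {p} x y → Prime p → p % 8 ≡ 5 → p ∣ sq x + 2 * sq y → p ∣ sq x × p ∣ sq y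
p∣sq+2sq⇒p∣sq-both {p} x y p-prime p%8≡5 p∣x²+2y² =
  ∣m+n∣m⇒∣n (subst (p ∣_) (+-comm (sq x) _) p∣x²+2y²) (∣n⇒∣m*n 2 p∣y²) , p∣y²
  where
  p∣y² : p ∣ sq y
  p∣y² = ∣m⇒∣m*n y (p∣sq+2sq⇒p∣y x y p-prime p%8≡5 p∣x²+2y²)

complement-∣ : ∀ {p X Y E} → X + Y ≡ 2 * E → p ∣ E → p ∣ X → p ∣ Y
complement-∣ {p} X+Y≡2E p∣E p∣X = ∣m+n∣m⇒∣n (subst (p ∣_) (sym X+Y≡2E) (∣n⇒∣m*n 2 p∣E)) p∣X

module _ {A B C D E F G H I : ℕ} where

  magic-sum≡3*centre : IsMagic A B C D E F G H I → A + B + C ≡ 3 * E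
  magic-sum≡3*centre (_ , r₂ , r₃ , _ , c₂ , _ , d₁ , d₂) =
    +-cancelˡ-≡ (3 * (A + B + C)) (A + B + C) (3 * E) (begin
    3 * (A + B + C) + (A + B + C)                              ≡⟨ solve (A ∷ B ∷ C ∷ []) ⟩
    (A + B + C) + (A + B + C) + (A + B + C) + (A + B + C)      ≡⟨ cong₂ _+_ (cong₂ _+_ (cong₂ _+_ r₂ c₂) d₁) d₂ ⟩
    (D + E + F) + (B + E + H) + (A + E + I) + (C + E + G)      ≡⟨ solve (A ∷ B ∷ C ∷ D ∷ E ∷ F ∷ G ∷ H ∷ I ∷ []) ⟩
    (A + B + C) + (D + E + F) + (G + H + I) + 3 * E            ≡⟨ cong₂ (λ X Y → (A + B + C) + X + Y + 3 * E) r₂ r₃ ⟨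
    (A + B + C) + (A + B + C) + (A + B + C) + 3 * E            ≡⟨ solve (A ∷ B ∷ C ∷ E ∷ []) ⟩
    3 * (A + B + C) + 3 * E                                    ∎)
    where open ≡-Reasoning

  magic-opposite : IsMagic A B C D E F G H I → ∀ X Y → A + B + C ≡ X + E + Y → X + Y ≡ 2 * E
  magic-opposite magic X Y line = +-cancelʳ-≡ E (X + Y) (2 * E) (begin
    X + Y + E      ≡⟨ solve (X ∷ Y ∷ E ∷ []) ⟩
    X + E + Y      ≡⟨ line ⟨
    A + B + C      ≡⟨ magic-sum≡3*centre magic ⟩
    3 * E          ≡⟨ solve (E ∷ []) ⟩
    2 * E + E      ∎)
    where open ≡-Reasoning

  magic-edges+corner : IsMagic A B C D E F G H I → B + D + 2 * A ≡ 4 * E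
  magic-edges+corner magic@(_ , _ , _ , c₁ , _ , _ , _ , d₂) = +-cancelʳ-≡ (C + G) _ _ (begin
    B + D + 2 * A + (C + G)      ≡⟨ solve (A ∷ B ∷ C ∷ D ∷ G ∷ []) ⟩
    (A + B + C) + (A + D + G)    ≡⟨ cong ((A + B + C) +_) c₁ ⟨
    (A + B + C) + (A + B + C)    ≡⟨ cong₂ _+_ 3E 3E ⟩
    3 * E + 3 * E                ≡⟨ solve (E ∷ []) ⟩
    4 * E + 2 * E                ≡⟨ cong (4 * E +_) (magic-opposite magic C G d₂) ⟨
    4 * E + (C + G)              ∎)
    where
    open ≡-Reasoning
    3E : A + B + C ≡ 3 * E
    3E = magic-sum≡3*centre magic

  primitive-divisor≡1 : ∀ {p} → Primitive9 A B C D E F G H I →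
                        p ∣ A → p ∣ B → p ∣ C → p ∣ D → p ∣ E → p ∣ F → p ∣ G → p ∣ H → p ∣ I → p ≡ 1
  primitive-divisor≡1 {p} gcd≡1 p∣A p∣B p∣C p∣D p∣E p∣F p∣G p∣H p∣I =
    ∣1⇒≡1 (subst (p ∣_) gcd≡1
      (gcd-greatest p∣A (gcd-greatest p∣B (gcd-greatest p∣C (gcd-greatest p∣D (gcd-greatest p∣E
        (gcd-greatest p∣F (gcd-greatest p∣G (gcd-greatest p∣H p∣I)))))))))

  primitive-magic-divisor≡1 : ∀ {p} → IsMagic A B C D E F G H I → Primitive9 A B C D E F G H I →
                              p ∣ E → p ∣ A → p ∣ B → p ∣ D → p ≡ 1
  primitive-magic-divisor≡1 {p} magic@(_ , r₂ , _ , _ , c₂ , _ , d₁ , d₂) gcd≡1 p∣E p∣A p∣B p∣D =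
    primitive-divisor≡1 gcd≡1 p∣A p∣B p∣C p∣D p∣E (partner D F r₂ p∣D) (partner C G d₂ p∣C)
      (partner B H c₂ p∣B) (partner A I d₁ p∣A)
    where
    partner : ∀ X Y → A + B + C ≡ X + E + Y → p ∣ X → p ∣ Y
    partner X Y line = complement-∣ (magic-opposite magic X Y line) p∣E
    p∣C : p ∣ C
    p∣C = ∣m+n∣m⇒∣n (subst (p ∣_) (sym (magic-sum≡3*centre magic)) (∣n⇒∣m*n 3 p∣E)) (∣m∣n⇒∣m+n p∣A p∣B)

corollary4p2 : (a b c d e f g h i p : ℕ) →
    IsPrimitiveMagicSquareOfSquares a b c d e f g h i →
    Prime p → p % 8 ≡ 5 → p ∣ sq e →
    ¬ (p ∣ sq b) × ¬ (p ∣ sq d) × ¬ (p ∣ sq f) × ¬ (p ∣ sq h)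
corollary4p2 a b c d e f g h i p (magic@(_ , r₂ , _ , _ , c₂ , _ , _ , _) , gcd≡1) p-prime p%8≡5 p∣E =
  p∤B , p∤D , p∤D ∘ complement-∣ F+D≡2E p∣E , p∤B ∘ complement-∣ H+B≡2E p∣E
  where
  F+D≡2E : sq f + sq d ≡ 2 * sq e
  F+D≡2E = trans (+-comm (sq f) (sq d)) (magic-opposite magic (sq d) (sq f) r₂)
  H+B≡2E : sq h + sq b ≡ 2 * sq e
  H+B≡2E = trans (+-comm (sq h) (sq b)) (magic-opposite magic (sq b) (sq h) c₂)
  p≢1 : p ≢ 1
  p≢1 refl = ¬prime[1] p-prime
  p∣B+D+2A : p ∣ sq b + sq d + 2 * sq a
  p∣B+D+2A = subst (p ∣_) (sym (magic-edges+corner magic)) (∣n⇒∣m*n 4 p∣E)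
  p∤B : ¬ p ∣ sq b
  p∤B p∣B =
    let p∣D , p∣A = p∣sq+2sq⇒p∣sq-both d a p-prime p%8≡5
                      (∣m+n∣m⇒∣n (subst (p ∣_) (+-assoc (sq b) _ _) p∣B+D+2A) p∣B)
    in p≢1 (primitive-magic-divisor≡1 magic gcd≡1 p∣E p∣A p∣B p∣D)
  B+D+2A≡D+[B+2A] : sq b + sq d + 2 * sq a ≡ sq d + (sq b + 2 * sq a)
  B+D+2A≡D+[B+2A] = trans (cong (_+ 2 * sq a) (+-comm (sq b) (sq d))) (+-assoc (sq d) _ _)
  p∤D : ¬ p ∣ sq d
  p∤D p∣D =
    let p∣B , p∣A = p∣sq+2sq⇒p∣sq-both b a p-prime p%8≡5
                      (∣m+n∣m⇒∣n (subst (p ∣_) B+D+2A≡D+[B+2A] p∣B+D+2A) p∣D)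
    in p≢1 (primitive-magic-divisor≡1 magic gcd≡1 p∣E p∣A p∣B p∣D)
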